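{- Let $\Sigma$ be a many-sorted signature split by $\Lambda$ into $\{\Sigma_\lambda:\lambda\in\Lambda\}$. Then every $\Sigma$-formula is equivalent to a formula in $\Lambda$-GDNF.
   Context: Many-sorted first-order logic: a signature $\Sigma$ has a nonempty set $\mathcal{S}_\Sigma$ of sorts, function symbols $\mathcal{F}_\Sigma$ and predicate symbols $\mathcal{P}_\Sigma$ (including equality for each sort) with sorted arities. $\Sigma$ is split by $\Lambda$ into signatures $\{\Sigma_\lambda:\lambda\in\Lambda\}$ if $\Lambda$ is a partition of $\mathcal{S}_\Sigma$, each $\Sigma_\lambda$ is a signature with sort set $\lambda$, $\mathcal{F}_\Sigma=\bigcup_\lambda\mathcal{F}_{\Sigma_\lambda}$ and $\mathcal{P}_\Sigma=\bigcup_\lambda\mathcal{P}_{\Sigma_\lambda}$. A generalized $\Lambda$-cube is a conjunction $\bigwedge_{i=1}^n\varphi_i$ where each $\varphi_i$ is a $\Sigma_{\lambda_i}$-formula with $\lambda_i\in\Lambda$ pairwise distinct. A formula is in $\Lambda$-GDNF if it is a disjunction of generalized $\Lambda$-cubes. Two formulas are equivalent if they are satisfied by exactly the same $\Sigma$-interpretations (structure plus variable assignment). -}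

module Defs where

open import Level using (0ℓ)
open import Data.List using (List; []; _∷_)
open import Data.List.Membership.Propositional using (_∈_)
open import Data.List.Relation.Unary.All as All using (All)
open import Data.List.Relation.Unary.Unique.Propositional using (Unique)
open import Data.Product using (Σ; ∃; ∃-syntax; _×_; _,_)
open import Data.Sum using (_⊎_)
open import Data.Unit using (⊤)
open import Data.Empty using (⊥)
open import Relation.Binary.PropositionalEquality using (_≡_)
open import Function.Bundles using (_⇔_)

-- Many-sorted signatures.  Equality on each sort is built into the
-- syntax (formula constructor `eq`), so it is not a member of Pred.

record Signature : Set₁ where
  field
    Sort  : Set
    sort-nonempty : Sort
    Fun   : Set
    Pred  : Set
    fargs : Fun → List Sort
    fres  : Fun → Sort
    pargs : Pred → List Sort

-- Syntax: terms and formulas in a context Γ of (sorted) free variables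
-- (de Bruijn style: a variable of sort s is a proof s ∈ Γ).

module Syntax (S : Signature) where
  open Signature S

  data Term (Γ : List Sort) : Sort → Set
  data Terms (Γ : List Sort) : List Sort → Set

  data Term Γ where
    var : ∀ {s} → s ∈ Γ → Term Γ s
    app : (f : Fun) → Terms Γ (fargs f) → Term Γ (fres f)

  data Terms Γ where
    []  : Terms Γ []
    _∷_ : ∀ {s ss} → Term Γ s → Terms Γ ss → Terms Γ (s ∷ ss)

  data Formula (Γ : List Sort) : Set where
    tt ff : Formula Γ
    eq    : (s : Sort) → Term Γ s → Term Γ s → Formula Γ
    rel   : (p : Pred) → Terms Γ (pargs p) → Formula Γ
    not   : Formula Γ → Formula Γ
    and or imp : Formula Γ → Formula Γ → Formula Γ
    all ex : (s : Sort) → Formula (s ∷ Γ) → Formula Γ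

record Structure (S : Signature) : Set₁ where
  open Signature S
  field
    Carrier  : Sort → Set
    nonempty : (s : Sort) → Carrier s
    funI     : (f : Fun) → All Carrier (fargs f) → Carrier (fres f)
    relI     : (p : Pred) → All Carrier (pargs p) → Set

module Semantics {S : Signature} (M : Structure S) where
  open Signature S
  open Syntax S
  open Structure M

  Env : List Sort → Set
  Env Γ = All Carrier Γ

  evalT  : ∀ {Γ s} → Term Γ s → Env Γ → Carrier s
  evalTs : ∀ {Γ ss} → Terms Γ ss → Env Γ → All Carrier ss
  evalT (var x)    ρ = All.lookup ρ x
  evalT (app f ts) ρ = funI f (evalTs ts ρ)
  evalTs []       ρ = All.[]
  evalTs (t ∷ ts) ρ = evalT t ρ All.∷ evalTs ts ρ

  ⟦_⟧ : ∀ {Γ} → Formula Γ → Env Γ → Set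
  ⟦ tt ⟧        ρ = ⊤
  ⟦ ff ⟧        ρ = ⊥
  ⟦ eq s t u ⟧  ρ = evalT t ρ ≡ evalT u ρ
  ⟦ rel p ts ⟧  ρ = relI p (evalTs ts ρ)
  ⟦ not φ ⟧     ρ = ⟦ φ ⟧ ρ → ⊥
  ⟦ and φ ψ ⟧   ρ = ⟦ φ ⟧ ρ × ⟦ ψ ⟧ ρ
  ⟦ or φ ψ ⟧    ρ = ⟦ φ ⟧ ρ ⊎ ⟦ ψ ⟧ ρ
  ⟦ imp φ ψ ⟧   ρ = ⟦ φ ⟧ ρ → ⟦ ψ ⟧ ρ
  ⟦ all s φ ⟧   ρ = (a : Carrier s) → ⟦ φ ⟧ (a All.∷ ρ)
  ⟦ ex s φ ⟧    ρ = Σ (Carrier s) (λ a → ⟦ φ ⟧ (a All.∷ ρ))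

Equivalent : {S : Signature} {Γ : List (Signature.Sort S)} →
             Syntax.Formula S Γ → Syntax.Formula S Γ → Set₁
Equivalent {S} {Γ} φ ψ =
  (M : Structure S) (ρ : Semantics.Env M Γ) →
  Semantics.⟦_⟧ M φ ρ ⇔ Semantics.⟦_⟧ M ψ ρ

-- Σ split by a partition Λ of the sorts into signatures Σ_l.

record Split (S : Signature) (Λ : Set) : Set₁ where
  open Signature S
  field
    part        : Sort → Λ
    part-onto   : (l : Λ) → ∃[ s ] part s ≡ l
    FunIn       : Fun → Λ → Set
    PredIn      : Pred → Λ → Set
    fun-covered : (f : Fun) → ∃[ l ] FunIn f l
    pred-covered : (p : Pred) → ∃[ l ] PredIn p l
    fun-sorts   : ∀ {f l} → FunIn f l →
                  All (λ s → part s ≡ l) (fargs f) × part (fres f) ≡ l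
    pred-sorts  : ∀ {p l} → PredIn p l → All (λ s → part s ≡ l) (pargs p)

module Blocks {S : Signature} {Λ : Set} (sp : Split S Λ) where
  open Signature S
  open Syntax S
  open Split sp

  data TermIn (l : Λ) {Γ : List Sort} : ∀ {s} → Term Γ s → Set
  data TermsIn (l : Λ) {Γ : List Sort} : ∀ {ss} → Terms Γ ss → Set

  data TermIn l {Γ} where
    var : ∀ {s} {x : s ∈ Γ} → part s ≡ l → TermIn l (var x)
    app : ∀ {f} {ts : Terms Γ (fargs f)} → FunIn f l → TermsIn l ts →
          TermIn l (app f ts)

  data TermsIn l {Γ} where
    []  : TermsIn l []
    _∷_ : ∀ {s ss} {t : Term Γ s} {ts : Terms Γ ss} →
          TermIn l t → TermsIn l ts → TermsIn l (t ∷ ts)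

  data FormulaIn (l : Λ) : {Γ : List Sort} → Formula Γ → Set where
    tt  : ∀ {Γ} → FormulaIn l {Γ} tt
    ff  : ∀ {Γ} → FormulaIn l {Γ} ff
    eq  : ∀ {Γ s} {t u : Term Γ s} → part s ≡ l →
          TermIn l t → TermIn l u → FormulaIn l (eq s t u)
    rel : ∀ {Γ p} {ts : Terms Γ (pargs p)} → PredIn p l →
          TermsIn l ts → FormulaIn l (rel p ts)
    not : ∀ {Γ} {φ : Formula Γ} → FormulaIn l φ → FormulaIn l (not φ)
    and : ∀ {Γ} {φ ψ : Formula Γ} → FormulaIn l φ → FormulaIn l ψ →
          FormulaIn l (and φ ψ)
    or  : ∀ {Γ} {φ ψ : Formula Γ} → FormulaIn l φ → FormulaIn l ψ →
          FormulaIn l (or φ ψ)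
    imp : ∀ {Γ} {φ ψ : Formula Γ} → FormulaIn l φ → FormulaIn l ψ →
          FormulaIn l (imp φ ψ)
    all : ∀ {Γ s} {φ : Formula (s ∷ Γ)} → part s ≡ l → FormulaIn l φ →
          FormulaIn l (all s φ)
    ex  : ∀ {Γ s} {φ : Formula (s ∷ Γ)} → part s ≡ l → FormulaIn l φ →
          FormulaIn l (ex s φ)

  -- φ is a (right-nested, n ≥ 1) conjunction φ₁ ∧ … ∧ φₙ with φᵢ a
  -- Σ_{lᵢ}-formula; the list records l₁ … lₙ.
  data ConjOf {Γ : List Sort} : Formula Γ → List Λ → Set where
    one  : ∀ {l φ} → FormulaIn l φ → ConjOf φ (l ∷ [])
    cons : ∀ {l ls φ ψ} → FormulaIn l φ → ConjOf ψ ls →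
           ConjOf (and φ ψ) (l ∷ ls)

  IsCube : ∀ {Γ} → Formula Γ → Set
  IsCube φ = ∃[ ls ] (ConjOf φ ls × Unique ls)

  data IsGDNF {Γ : List Sort} : Formula Γ → Set where
    one  : ∀ {φ} → IsCube φ → IsGDNF φ
    cons : ∀ {φ ψ} → IsCube φ → IsGDNF ψ → IsGDNF (or φ ψ)

-- Translate φ into a disjunction of conjunctions of block formulas, i.e. of Σ_l-formulas
-- for varying blocks l. Atoms are block formulas, since every symbol occurring in a term of
-- sort s belongs to the block of s. The connectives are handled propositionally (classically,
-- by distributivity and De Morgan) and ∀ as ¬∃¬. The one genuinely first-order case is ∃x:s
-- over a conjunction: the conjuncts outside the block of s do not mention x, so the
-- quantifier moves past them onto the conjunction of the remaining ones, which is again a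
-- block formula. Merging conjuncts of equal block finally makes the blocks of each cube
-- pairwise distinct.

module Submission where

open import Defs
open import Level using (0ℓ)
open import Axiom.ExcludedMiddle using (ExcludedMiddle)
open import Axiom.DoubleNegationElimination using (em⇒dne)
open import Data.Empty using (⊥-elim)
open import Data.List using (List; []; _∷_; _++_; map; foldr; cartesianProductWith)
open import Data.List.Membership.Propositional using (_∈_)
open import Data.List.Relation.Unary.All as All using (All; []; _∷_)
import Data.List.Relation.Unary.All.Properties as All
open import Data.List.Relation.Unary.Any as Any using (Any; here; there)
import Data.List.Relation.Unary.Any.Properties as Any
open import Data.List.Relation.Unary.AllPairs using ([]; _∷_)
open import Data.List.Relation.Unary.Unique.Propositional using (Unique)
open import Data.Product using (Σ; ∃-syntax; Σ-syntax; _×_; _,_; proj₁)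
open import Data.Product.Function.NonDependent.Propositional using (_×-⇔_)
open import Data.Sum using (_⊎_; inj₁; inj₂; [_,_])
open import Data.Sum.Function.Propositional using (_⊎-⇔_)
open import Data.Unit using (tt)
open import Function using (_∘_)
open import Function.Bundles using (_⇔_; mk⇔; module Equivalence)
import Function.Properties.Equivalence as ⇔
open import Function.Properties.Inverse using (↔⇒⇔)
import Function.Related.Propositional as Related
open import Function.Related.TypeIsomorphisms using (¬-cong-⇔; →-cong-⇔)
open import Relation.Binary.Definitions using (DecidableEquality)
open import Relation.Binary.PropositionalEquality
  using (_≡_; _≢_; refl; sym; subst; subst₂; cong; cong₂)
open import Relation.Nullary using (Dec; yes; no; ¬_)
open import Relation.Nullary.Negation using (∀¬⟶¬∃; ¬∃⟶∀¬)
open import Relation.Unary using (Decidable)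

open Equivalence using (to; from)

Any-cong-⇔ : {A : Set} {P Q : A → Set} {xs : List A} → (∀ {x} → P x ⇔ Q x) → Any P xs ⇔ Any Q xs
Any-cong-⇔ P⇔Q = mk⇔ (Any.map (to P⇔Q)) (Any.map (from P⇔Q))

All-∷-⇔ : {A : Set} {P : A → Set} {x : A} {xs : List A} → All P (x ∷ xs) ⇔ (P x × All P xs)
All-∷-⇔ = mk⇔ All.uncons (λ (p , ps) → p ∷ ps)

module PropositionalDNF {A : Set} where

  DNF : Set
  DNF = List (List A)

  _∧ᴰ_ : DNF → DNF → DNF
  _∧ᴰ_ = cartesianProductWith _++_

  module _ (neg : A → A) where

    ¬ᶜ : List A → DNF
    ¬ᶜ = map (λ a → neg a ∷ [])

    ¬ᴰ : DNF → DNF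
    ¬ᴰ = foldr (λ c d → ¬ᶜ c ∧ᴰ d) ([] ∷ [])

  module Valuation (P : A → Set) where

    Holds : DNF → Set
    Holds = Any (All P)

    ∧ᴰ-sem : ∀ d e → Holds (d ∧ᴰ e) ⇔ (Holds d × Holds e)
    ∧ᴰ-sem d e = mk⇔ (Any.cartesianProductWith⁻ _++_ (All.++⁻ _) d e)
                     (λ (p , q) → Any.cartesianProductWith⁺ _++_ All.++⁺ p q)

    ++-sem : ∀ d e → Holds (d ++ e) ⇔ (Holds d ⊎ Holds e)
    ++-sem d e = ⇔.sym (↔⇒⇔ Any.++↔)

    module _ (P? : Decidable P) {neg : A → A} (P-neg : ∀ a → P (neg a) ⇔ (¬ P a)) where

      ¬ᶜ-sem : ∀ c → Holds (¬ᶜ neg c) ⇔ (¬ All P c)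
      ¬ᶜ-sem c = mk⇔
        (λ h → All.Any¬⇒¬All (Any.map (to (P-neg _) ∘ All.singleton⁻) (Any.map⁻ h)))
        (λ ¬all → Any.map⁺ (Any.map (λ ¬p → from (P-neg _) ¬p ∷ [])
                                    (All.¬All⇒Any¬ P? c ¬all)))

      ¬ᴰ-sem : ∀ d → Holds (¬ᴰ neg d) ⇔ (¬ Holds d)
      ¬ᴰ-sem [] = mk⇔ (λ _ ()) (λ _ → here [])
      ¬ᴰ-sem (c ∷ d) = begin
        Holds (¬ᴰ neg (c ∷ d))                ∼⟨ ∧ᴰ-sem (¬ᶜ neg c) (¬ᴰ neg d) ⟩
        (Holds (¬ᶜ neg c) × Holds (¬ᴰ neg d)) ∼⟨ ¬ᶜ-sem c ×-⇔ ¬ᴰ-sem d ⟩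
        (¬ All P c × ¬ Holds d)               ∼⟨ mk⇔ (λ (¬c , ¬d) → λ { (here p)  → ¬c p
                                                                       ; (there q) → ¬d q })
                                                     (λ ¬cd → (¬cd ∘ here) , (¬cd ∘ there)) ⟩
        (¬ Holds (c ∷ d))                     ∎
        where open Related.EquationalReasoning

module Grouping {K : Set} (_≟_ : DecidableEquality K) {F : K → Set}
                (_⊗_ : ∀ {k} → F k → F k → F k) where

  insert : Σ K F → List (Σ K F) → List (Σ K F)
  insert x [] = x ∷ []
  insert (k , x) ((k′ , y) ∷ ys) with k ≟ k′
  ... | yes refl = (k , x ⊗ y) ∷ ys
  ... | no _     = (k′ , y) ∷ insert (k , x) ys

  group : List (Σ K F) → List (Σ K F)
  group = foldr insert []

  keys : List (Σ K F) → List K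
  keys = map proj₁

  insert-keys : (Q : K → Set) {k : K} (x : F k) (ys : List (Σ K F)) →
                Q k → All Q (keys ys) → All Q (keys (insert (k , x) ys))
  insert-keys Q x [] qk [] = qk ∷ []
  insert-keys Q {k} x ((k′ , y) ∷ ys) qk (qk′ ∷ qys) with k ≟ k′
  ... | yes refl = qk′ ∷ qys
  ... | no _     = qk′ ∷ insert-keys Q x ys qk qys

  insert-unique : ∀ x ys → Unique (keys ys) → Unique (keys (insert x ys))
  insert-unique x [] [] = [] ∷ []
  insert-unique (k , x) ((k′ , y) ∷ ys) (k′∉ys ∷ u) with k ≟ k′
  ... | yes refl = k′∉ys ∷ u
  ... | no k≢k′  = insert-keys (k′ ≢_) x ys (k≢k′ ∘ sym) k′∉ys ∷ insert-unique (k , x) ys u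

  group-unique : ∀ xs → Unique (keys (group xs))
  group-unique []       = []
  group-unique (x ∷ xs) = insert-unique x (group xs) (group-unique xs)

  module _ (P : Σ K F → Set)
           (P-⊗ : ∀ {k} (x y : F k) → P (k , x ⊗ y) ⇔ (P (k , x) × P (k , y))) where

    insert-sem : ∀ x ys → All P (insert x ys) ⇔ (P x × All P ys)
    insert-sem x [] = All-∷-⇔
    insert-sem (k , x) ((k′ , y) ∷ ys) with k ≟ k′
    ... | yes refl = mk⇔ (λ { (pxy ∷ pys) → let px , py = to (P-⊗ x y) pxy in px , py ∷ pys })
                         (λ { (px , py ∷ pys) → from (P-⊗ x y) (px , py) ∷ pys })
    ... | no _     = mk⇔ (λ { (py ∷ p) → let px , pys = to ih p in px , py ∷ pys })
                         (λ { (px , py ∷ pys) → py ∷ from ih (px , pys) })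
      where ih = insert-sem (k , x) ys

    group-sem : ∀ xs → All P (group xs) ⇔ All P xs
    group-sem []       = ⇔.refl
    group-sem (x ∷ xs) = begin
      All P (insert x (group xs)) ∼⟨ insert-sem x (group xs) ⟩
      (P x × All P (group xs))    ∼⟨ ⇔.refl ×-⇔ group-sem xs ⟩
      (P x × All P xs)            ∼⟨ ⇔.sym All-∷-⇔ ⟩
      All P (x ∷ xs)              ∎
      where open Related.EquationalReasoning

module BlockRenaming {S : Signature} {Λ : Set} (sp : Split S Λ) where
  open Signature S
  open Syntax S
  open Split sp
  open Blocks sp

  termIn-part : ∀ {Γ s} (t : Term Γ s) → TermIn (part s) t
  termsIn : ∀ {Γ ss l} (ts : Terms Γ ss) → All (λ s → part s ≡ l) ss → TermsIn l ts
  termIn-part (var x) = var refl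
  termIn-part (app f ts) with fun-covered f
  ... | l , f∈l with fun-sorts f∈l
  ...   | args∈l , refl = app f∈l (termsIn ts args∈l)
  termsIn []       []           = []
  termsIn (t ∷ ts) (refl ∷ ss∈l) = termIn-part t ∷ termsIn ts ss∈l

  -- A Σ_l-formula only mentions variables of block l, so only those need to be renamed.
  Renaming : Λ → List Sort → List Sort → Set
  Renaming l Γ Δ = ∀ {s} → part s ≡ l → s ∈ Γ → s ∈ Δ

  lift : ∀ {l Γ Δ s} → Renaming l Γ Δ → Renaming l (s ∷ Γ) (s ∷ Δ)
  lift r _   (here s≡t) = here s≡t
  lift r s∈l (there x)  = there (r s∈l x)

  strengthen : ∀ {l s Γ} → ¬ l ≡ part s → Renaming l (s ∷ Γ) Γ
  strengthen l≢s s∈l (here refl) = ⊥-elim (l≢s (sym s∈l))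
  strengthen l≢s _   (there x)   = x

  renameᵗ : ∀ {l Γ Δ s} {t : Term Γ s} → Renaming l Γ Δ → TermIn l t → Term Δ s
  renameᵗˢ : ∀ {l Γ Δ ss} {ts : Terms Γ ss} → Renaming l Γ Δ → TermsIn l ts → Terms Δ ss
  renameᵗ r (var {x = x} s∈l)   = var (r s∈l x)
  renameᵗ r (app {f = f} _ ts∈l) = app f (renameᵗˢ r ts∈l)
  renameᵗˢ r []          = []
  renameᵗˢ r (t∈l ∷ ts∈l) = renameᵗ r t∈l ∷ renameᵗˢ r ts∈l

  renameᵗ-in : ∀ {l Γ Δ s} {t : Term Γ s} (r : Renaming l Γ Δ) (t∈l : TermIn l t) →
               TermIn l (renameᵗ r t∈l)
  renameᵗˢ-in : ∀ {l Γ Δ ss} {ts : Terms Γ ss} (r : Renaming l Γ Δ) (ts∈l : TermsIn l ts) →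
                TermsIn l (renameᵗˢ r ts∈l)
  renameᵗ-in r (var s∈l)       = var s∈l
  renameᵗ-in r (app f∈l ts∈l)  = app f∈l (renameᵗˢ-in r ts∈l)
  renameᵗˢ-in r []             = []
  renameᵗˢ-in r (t∈l ∷ ts∈l)   = renameᵗ-in r t∈l ∷ renameᵗˢ-in r ts∈l

  renameᶠ : ∀ {l Γ Δ} {φ : Formula Γ} → Renaming l Γ Δ → FormulaIn l φ → Formula Δ
  renameᶠ r tt                      = tt
  renameᶠ r ff                      = ff
  renameᶠ r (eq {s = s} _ t∈l u∈l)  = eq s (renameᵗ r t∈l) (renameᵗ r u∈l)
  renameᶠ r (rel {p = p} _ ts∈l)    = rel p (renameᵗˢ r ts∈l)
  renameᶠ r (not φ∈l)               = not (renameᶠ r φ∈l)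
  renameᶠ r (and φ∈l ψ∈l)           = and (renameᶠ r φ∈l) (renameᶠ r ψ∈l)
  renameᶠ r (or φ∈l ψ∈l)            = or (renameᶠ r φ∈l) (renameᶠ r ψ∈l)
  renameᶠ r (imp φ∈l ψ∈l)           = imp (renameᶠ r φ∈l) (renameᶠ r ψ∈l)
  renameᶠ r (all {s = s} _ φ∈l)     = all s (renameᶠ (lift r) φ∈l)
  renameᶠ r (ex {s = s} _ φ∈l)      = ex s (renameᶠ (lift r) φ∈l)

  renameᶠ-in : ∀ {l Γ Δ} {φ : Formula Γ} (r : Renaming l Γ Δ) (φ∈l : FormulaIn l φ) →
               FormulaIn l (renameᶠ r φ∈l)
  renameᶠ-in r tt                  = tt
  renameᶠ-in r ff                  = ff
  renameᶠ-in r (eq s∈l t∈l u∈l)    = eq s∈l (renameᵗ-in r t∈l) (renameᵗ-in r u∈l)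
  renameᶠ-in r (rel p∈l ts∈l)      = rel p∈l (renameᵗˢ-in r ts∈l)
  renameᶠ-in r (not φ∈l)           = not (renameᶠ-in r φ∈l)
  renameᶠ-in r (and φ∈l ψ∈l)       = and (renameᶠ-in r φ∈l) (renameᶠ-in r ψ∈l)
  renameᶠ-in r (or φ∈l ψ∈l)        = or (renameᶠ-in r φ∈l) (renameᶠ-in r ψ∈l)
  renameᶠ-in r (imp φ∈l ψ∈l)       = imp (renameᶠ-in r φ∈l) (renameᶠ-in r ψ∈l)
  renameᶠ-in r (all s∈l φ∈l)       = all s∈l (renameᶠ-in (lift r) φ∈l)
  renameᶠ-in r (ex s∈l φ∈l)        = ex s∈l (renameᶠ-in (lift r) φ∈l)

  module _ (M : Structure S) where
    open Structure M
    open Semantics M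

    Agrees : ∀ {l Γ Δ} → Renaming l Γ Δ → Env Γ → Env Δ → Set
    Agrees {l} {Γ} r ρ σ = ∀ {s} (s∈l : part s ≡ l) (x : s ∈ Γ) →
                           All.lookup σ (r s∈l x) ≡ All.lookup ρ x

    lift-agrees : ∀ {l Γ Δ s} {r : Renaming l Γ Δ} {ρ σ} → Agrees r ρ σ →
                  (a : Carrier s) → Agrees (lift r) (a ∷ ρ) (a ∷ σ)
    lift-agrees r≈ a _   (here refl) = refl
    lift-agrees r≈ a s∈l (there x)   = r≈ s∈l x

    strengthen-agrees : ∀ {l s Γ} (l≢s : ¬ l ≡ part s) (a : Carrier s) (ρ : Env Γ) →
                        Agrees (strengthen l≢s) (a ∷ ρ) ρ
    strengthen-agrees l≢s a ρ s∈l (here refl) = ⊥-elim (l≢s (sym s∈l))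
    strengthen-agrees l≢s a ρ _   (there x)   = refl

    renameᵗ-sem : ∀ {l Γ Δ s} {t : Term Γ s} {r : Renaming l Γ Δ} {ρ σ} → Agrees r ρ σ →
                  (t∈l : TermIn l t) → evalT (renameᵗ r t∈l) σ ≡ evalT t ρ
    renameᵗˢ-sem : ∀ {l Γ Δ ss} {ts : Terms Γ ss} {r : Renaming l Γ Δ} {ρ σ} → Agrees r ρ σ →
                   (ts∈l : TermsIn l ts) → evalTs (renameᵗˢ r ts∈l) σ ≡ evalTs ts ρ
    renameᵗ-sem r≈ (var {x = x} s∈l)   = r≈ s∈l x
    renameᵗ-sem r≈ (app {f = f} _ ts∈l) = cong (funI f) (renameᵗˢ-sem r≈ ts∈l)
    renameᵗˢ-sem r≈ []                 = refl
    renameᵗˢ-sem r≈ (t∈l ∷ ts∈l)       = cong₂ All._∷_ (renameᵗ-sem r≈ t∈l) (renameᵗˢ-sem r≈ ts∈l)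

    renameᶠ-sem : ∀ {l Γ Δ} {φ : Formula Γ} {r : Renaming l Γ Δ} {ρ σ} → Agrees r ρ σ →
                  (φ∈l : FormulaIn l φ) → ⟦ renameᶠ r φ∈l ⟧ σ ⇔ ⟦ φ ⟧ ρ
    renameᶠ-sem r≈ tt               = ⇔.refl
    renameᶠ-sem r≈ ff               = ⇔.refl
    renameᶠ-sem r≈ (eq _ t∈l u∈l)   = mk⇔ (subst₂ _≡_ t≡ u≡) (subst₂ _≡_ (sym t≡) (sym u≡))
      where t≡ = renameᵗ-sem r≈ t∈l
            u≡ = renameᵗ-sem r≈ u∈l
    renameᶠ-sem r≈ (rel {p = p} _ ts∈l) = mk⇔ (subst (relI p) ts≡) (subst (relI p) (sym ts≡))
      where ts≡ = renameᵗˢ-sem r≈ ts∈l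
    renameᶠ-sem r≈ (not φ∈l)        = ¬-cong-⇔ (renameᶠ-sem r≈ φ∈l)
    renameᶠ-sem r≈ (and φ∈l ψ∈l)    = renameᶠ-sem r≈ φ∈l ×-⇔ renameᶠ-sem r≈ ψ∈l
    renameᶠ-sem r≈ (or φ∈l ψ∈l)     = renameᶠ-sem r≈ φ∈l ⊎-⇔ renameᶠ-sem r≈ ψ∈l
    renameᶠ-sem r≈ (imp φ∈l ψ∈l)    = →-cong-⇔ (renameᶠ-sem r≈ φ∈l) (renameᶠ-sem r≈ ψ∈l)
    renameᶠ-sem r≈ (all _ φ∈l)      =
      mk⇔ (λ h a → to (renameᶠ-sem (lift-agrees r≈ a) φ∈l) (h a))
          (λ h a → from (renameᶠ-sem (lift-agrees r≈ a) φ∈l) (h a))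
    renameᶠ-sem r≈ (ex _ φ∈l)       =
      mk⇔ (λ (a , h) → a , to (renameᶠ-sem (lift-agrees r≈ a) φ∈l) h)
          (λ (a , h) → a , from (renameᶠ-sem (lift-agrees r≈ a) φ∈l) h)

module NormalForm (em : ExcludedMiddle 0ℓ) {S : Signature} {Λ : Set} (sp : Split S Λ) where
  open Signature S
  open Syntax S
  open Split sp
  open Blocks sp
  open BlockRenaming sp
  open PropositionalDNF

  BlockFormula : List Sort → Set
  BlockFormula Γ = Σ[ l ∈ Λ ] Σ[ φ ∈ Formula Γ ] FormulaIn l φ

  notᵇ : ∀ {Γ} → BlockFormula Γ → BlockFormula Γ
  notᵇ (l , φ , φ∈l) = l , not φ , not φ∈l

  literal : ∀ {Γ} → BlockFormula Γ → DNF {BlockFormula Γ}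
  literal b = (b ∷ []) ∷ []

  separate : ∀ {s Γ} → List (BlockFormula (s ∷ Γ)) →
             (Σ[ φ ∈ Formula (s ∷ Γ) ] FormulaIn (part s) φ) × List (BlockFormula Γ)
  separate [] = (tt , tt) , []
  separate {s} ((l , φ , φ∈l) ∷ c) with em {l ≡ part s} | separate c
  ... | yes refl | (ψ , ψ∈l) , rest = (and φ ψ , and φ∈l ψ∈l) , rest
  ... | no l≢s   | loc , rest       =
    loc , (l , renameᶠ (strengthen l≢s) φ∈l , renameᶠ-in (strengthen l≢s) φ∈l) ∷ rest

  ∃ᶜ : ∀ {s Γ} → List (BlockFormula (s ∷ Γ)) → List (BlockFormula Γ)
  ∃ᶜ {s} c = let (φ , φ∈s) , rest = separate c in (part s , ex s φ , ex refl φ∈s) ∷ rest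

  dnf : ∀ {Γ} → Formula Γ → DNF {BlockFormula Γ}
  dnf tt         = [] ∷ []
  dnf ff         = []
  dnf (eq s t u) = literal (part s , eq s t u , eq refl (termIn-part t) (termIn-part u))
  dnf (rel p ts) =
    let l , p∈l = pred-covered p in literal (l , rel p ts , rel p∈l (termsIn ts (pred-sorts p∈l)))
  dnf (not φ)    = ¬ᴰ notᵇ (dnf φ)
  dnf (and φ ψ)  = dnf φ ∧ᴰ dnf ψ
  dnf (or φ ψ)   = dnf φ ++ dnf ψ
  dnf (imp φ ψ)  = ¬ᴰ notᵇ (dnf φ) ++ dnf ψ
  dnf (all s φ)  = ¬ᴰ notᵇ (map ∃ᶜ (¬ᴰ notᵇ (dnf φ)))
  dnf (ex s φ)   = map ∃ᶜ (dnf φ)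

  module Merge {Γ : List Sort} =
    Grouping (λ (l l′ : Λ) → em) {F = λ l → Σ (Formula Γ) (FormulaIn l)}
             (λ (φ , φ∈l) (ψ , ψ∈l) → and φ ψ , and φ∈l ψ∈l)
  open Merge using (group; group-unique; keys)

  -- Λ is inhabited because the sorts are; tt and ff count as formulas of this block.
  someBlock : Λ
  someBlock = part sort-nonempty

  conj : ∀ {Γ} → List (BlockFormula Γ) → Formula Γ
  conj []                      = tt
  conj ((_ , φ , _) ∷ [])      = φ
  conj ((_ , φ , _) ∷ b ∷ bs)  = and φ (conj (b ∷ bs))

  conj-conjOf : ∀ {Γ} (b : BlockFormula Γ) bs → ConjOf (conj (b ∷ bs)) (keys (b ∷ bs))
  conj-conjOf (_ , _ , φ∈l) []       = one φ∈l
  conj-conjOf (_ , _ , φ∈l) (b ∷ bs) = cons φ∈l (conj-conjOf b bs)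

  conj-isCube : ∀ {Γ} (c : List (BlockFormula Γ)) → Unique (keys c) → IsCube (conj c)
  conj-isCube []       _ = someBlock ∷ [] , one tt , [] ∷ []
  conj-isCube (b ∷ bs) u = keys (b ∷ bs) , conj-conjOf b bs , u

  disj : ∀ {Γ} → List (Formula Γ) → Formula Γ
  disj []           = ff
  disj (φ ∷ [])     = φ
  disj (φ ∷ ψ ∷ ψs) = or φ (disj (ψ ∷ ψs))

  disj-isGDNF : ∀ {Γ} {φs : List (Formula Γ)} → All IsCube φs → IsGDNF (disj φs)
  disj-isGDNF []                 = one (someBlock ∷ [] , one ff , [] ∷ [])
  disj-isGDNF (φ∈ ∷ [])          = one φ∈
  disj-isGDNF (φ∈ ∷ ψ∈ ∷ ψs∈)    = cons φ∈ (disj-isGDNF (ψ∈ ∷ ψs∈))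

  gdnf : ∀ {Γ} → Formula Γ → Formula Γ
  gdnf φ = disj (map (conj ∘ group) (dnf φ))

  gdnf-isGDNF : ∀ {Γ} (φ : Formula Γ) → IsGDNF (gdnf φ)
  gdnf-isGDNF φ = disj-isGDNF (All.map⁺ (All.universal cube (dnf φ)))
    where
      cube : ∀ c → IsCube (conj (group c))
      cube c = conj-isCube (group c) (group-unique c)

  ¬¬-⇔ : {A : Set} → A ⇔ (¬ ¬ A)
  ¬¬-⇔ = mk⇔ (λ a ¬a → ¬a a) (em⇒dne em)

  →-⇔-¬⊎ : {A B : Set} → (A → B) ⇔ (¬ A ⊎ B)
  →-⇔-¬⊎ {A} {B} = mk⇔ (λ f → implication f em) [ (λ ¬a a → ⊥-elim (¬a a)) , (λ b _ → b) ]
    where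
      implication : (A → B) → Dec A → ¬ A ⊎ B
      implication f (yes a) = inj₂ (f a)
      implication f (no ¬a) = inj₁ ¬a

  module _ (M : Structure S) where
    open Structure M
    open Semantics M

    ⟦_⟧ᵇ : ∀ {Γ} → BlockFormula Γ → Env Γ → Set
    ⟦ (_ , φ , _) ⟧ᵇ ρ = ⟦ φ ⟧ ρ

    ⟦_⟧ᶜ : ∀ {Γ} → List (BlockFormula Γ) → Env Γ → Set
    ⟦ c ⟧ᶜ ρ = All (λ b → ⟦ b ⟧ᵇ ρ) c

    module BlockValuation {Γ} (ρ : Env Γ) = Valuation (λ (b : BlockFormula Γ) → ⟦ b ⟧ᵇ ρ)
    open BlockValuation using (Holds; ∧ᴰ-sem; ++-sem)

    ¬ᴰ-sem : ∀ {Γ} (ρ : Env Γ) d → Holds ρ (¬ᴰ notᵇ d) ⇔ (¬ Holds ρ d)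
    ¬ᴰ-sem ρ = BlockValuation.¬ᴰ-sem ρ (λ _ → em) (λ _ → ⇔.refl)

    separate-sem : ∀ {s Γ} (c : List (BlockFormula (s ∷ Γ))) (a : Carrier s) (ρ : Env Γ) →
                   let (φ , _) , rest = separate c in
                   ⟦ c ⟧ᶜ (a ∷ ρ) ⇔ (⟦ φ ⟧ (a ∷ ρ) × ⟦ rest ⟧ᶜ ρ)
    separate-sem [] a ρ = mk⇔ (λ _ → tt , []) (λ _ → [])
    separate-sem {s} ((l , φ , φ∈l) ∷ c) a ρ with em {l ≡ part s} | separate c | separate-sem c a ρ
    ... | yes refl | _ | ih = mk⇔ (λ { (p ∷ ps) → let q , qs = to ih ps in (p , q) , qs })
                                  (λ { ((p , q) , qs) → p ∷ from ih (q , qs) })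
    ... | no l≢s   | _ | ih = mk⇔ (λ { (p ∷ ps) → let q , qs = to ih ps in q , from φ≈ p ∷ qs })
                                  (λ { (q , p ∷ qs) → to φ≈ p ∷ from ih (q , qs) })
      where φ≈ = renameᶠ-sem M (strengthen-agrees M l≢s a ρ) φ∈l

    ∃ᶜ-sem : ∀ {s Γ} (c : List (BlockFormula (s ∷ Γ))) (ρ : Env Γ) →
             ⟦ ∃ᶜ c ⟧ᶜ ρ ⇔ (∃[ a ] ⟦ c ⟧ᶜ (a ∷ ρ))
    ∃ᶜ-sem c ρ = mk⇔ (λ { ((a , p) ∷ ps) → a , from (separate-sem c a ρ) (p , ps) })
                     (λ (a , h) → let p , ps = to (separate-sem c a ρ) h in (a , p) ∷ ps)

    ∃ᴰ-sem : ∀ {s Γ} (d : DNF {BlockFormula (s ∷ Γ)}) (ρ : Env Γ) →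
             Holds ρ (map ∃ᶜ d) ⇔ (∃[ a ] Holds (a ∷ ρ) d)
    ∃ᴰ-sem d ρ = begin
      Holds ρ (map ∃ᶜ d)                  ↔⟨ Any.map↔ ⟨
      Any (λ c → ⟦ ∃ᶜ c ⟧ᶜ ρ) d           ∼⟨ Any-cong-⇔ (λ {c} → ∃ᶜ-sem c ρ) ⟩
      Any (λ c → ∃[ a ] ⟦ c ⟧ᶜ (a ∷ ρ)) d ∼⟨ mk⇔ Any.Any-Σ⁻ʳ Any.Any-Σ⁺ʳ ⟩
      (∃[ a ] Holds (a ∷ ρ) d)            ∎
      where open Related.EquationalReasoning

    literal-sem : ∀ {Γ} (b : BlockFormula Γ) (ρ : Env Γ) → ⟦ b ⟧ᵇ ρ ⇔ Holds ρ (literal b)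
    literal-sem b ρ = mk⇔ (λ p → here (p ∷ [])) (λ { (here (p ∷ [])) → p })

    dnf-sem : ∀ {Γ} (φ : Formula Γ) (ρ : Env Γ) → ⟦ φ ⟧ ρ ⇔ Holds ρ (dnf φ)
    ¬dnf-sem : ∀ {Γ} (φ : Formula Γ) (ρ : Env Γ) → (¬ ⟦ φ ⟧ ρ) ⇔ Holds ρ (¬ᴰ notᵇ (dnf φ))

    ¬dnf-sem φ ρ = ⇔.trans (¬-cong-⇔ (dnf-sem φ ρ)) (⇔.sym (¬ᴰ-sem ρ (dnf φ)))

    dnf-sem tt ρ         = mk⇔ (λ _ → here []) (λ _ → tt)
    dnf-sem ff ρ         = mk⇔ (λ ()) (λ ())
    dnf-sem (eq s t u) ρ = literal-sem _ ρ
    dnf-sem (rel p ts) ρ = literal-sem _ ρ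
    dnf-sem (not φ) ρ    = ¬dnf-sem φ ρ
    dnf-sem (and φ ψ) ρ  =
      ⇔.trans (dnf-sem φ ρ ×-⇔ dnf-sem ψ ρ) (⇔.sym (∧ᴰ-sem ρ (dnf φ) (dnf ψ)))
    dnf-sem (or φ ψ) ρ   =
      ⇔.trans (dnf-sem φ ρ ⊎-⇔ dnf-sem ψ ρ) (⇔.sym (++-sem ρ (dnf φ) (dnf ψ)))
    dnf-sem (imp φ ψ) ρ  = begin
      (⟦ φ ⟧ ρ → ⟦ ψ ⟧ ρ)                            ∼⟨ →-⇔-¬⊎ ⟩
      (¬ ⟦ φ ⟧ ρ ⊎ ⟦ ψ ⟧ ρ)                          ∼⟨ ¬dnf-sem φ ρ ⊎-⇔ dnf-sem ψ ρ ⟩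
      (Holds ρ (¬ᴰ notᵇ (dnf φ)) ⊎ Holds ρ (dnf ψ))  ∼⟨ ⇔.sym (++-sem ρ _ _) ⟩
      Holds ρ (dnf (imp φ ψ))                        ∎
      where open Related.EquationalReasoning
    dnf-sem (all s φ) ρ  = begin
      (∀ a → ⟦ φ ⟧ (a ∷ ρ))                          ∼⟨ mk⇔ (λ h a → to (step a) (h a))
                                                            (λ h a → from (step a) (h a)) ⟩
      (∀ a → ¬ Holds (a ∷ ρ) ¬dnf)                   ∼⟨ mk⇔ ∀¬⟶¬∃ ¬∃⟶∀¬ ⟩
      (¬ (∃[ a ] Holds (a ∷ ρ) ¬dnf))                ∼⟨ ¬-cong-⇔ (⇔.sym (∃ᴰ-sem ¬dnf ρ)) ⟩
      (¬ Holds ρ (map ∃ᶜ ¬dnf))                      ∼⟨ ⇔.sym (¬ᴰ-sem ρ _) ⟩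
      Holds ρ (dnf (all s φ))                        ∎
      where
        open Related.EquationalReasoning
        ¬dnf = ¬ᴰ notᵇ (dnf φ)
        step : ∀ a → ⟦ φ ⟧ (a ∷ ρ) ⇔ (¬ Holds (a ∷ ρ) ¬dnf)
        step a = ⇔.trans ¬¬-⇔ (¬-cong-⇔ (¬dnf-sem φ (a ∷ ρ)))
    dnf-sem (ex s φ) ρ   = ⇔.trans (mk⇔ (λ (a , p) → a , to (dnf-sem φ (a ∷ ρ)) p)
                                         (λ (a , h) → a , from (dnf-sem φ (a ∷ ρ)) h))
                                   (⇔.sym (∃ᴰ-sem (dnf φ) ρ))

    conj-sem : ∀ {Γ} (c : List (BlockFormula Γ)) (ρ : Env Γ) → ⟦ conj c ⟧ ρ ⇔ ⟦ c ⟧ᶜ ρ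
    conj-sem []           ρ = mk⇔ (λ _ → []) (λ _ → tt)
    conj-sem (b ∷ [])     ρ = mk⇔ (λ p → p ∷ []) All.head
    conj-sem (b ∷ b′ ∷ bs) ρ =
      ⇔.trans (⇔.refl ×-⇔ conj-sem (b′ ∷ bs) ρ) (⇔.sym All-∷-⇔)

    disj-sem : ∀ {Γ} (φs : List (Formula Γ)) (ρ : Env Γ) → ⟦ disj φs ⟧ ρ ⇔ Any (λ φ → ⟦ φ ⟧ ρ) φs
    disj-sem []           ρ = mk⇔ (λ ()) (λ ())
    disj-sem (φ ∷ [])     ρ = mk⇔ here (λ { (here p) → p ; (there ()) })
    disj-sem (φ ∷ ψ ∷ ψs) ρ = ⇔.trans (⇔.refl ⊎-⇔ disj-sem (ψ ∷ ψs) ρ) (↔⇒⇔ (Any.∷↔ _))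

    gdnf-sem : ∀ {Γ} (φ : Formula Γ) (ρ : Env Γ) → ⟦ φ ⟧ ρ ⇔ ⟦ gdnf φ ⟧ ρ
    gdnf-sem φ ρ = begin
      ⟦ φ ⟧ ρ                                         ∼⟨ dnf-sem φ ρ ⟩
      Holds ρ (dnf φ)                                 ∼⟨ Any-cong-⇔ (λ {c} → ⇔.sym (group≈ c)) ⟩
      Any (λ c → ⟦ conj (group c) ⟧ ρ) (dnf φ)        ↔⟨ Any.map↔ ⟩
      Any (λ ψ → ⟦ ψ ⟧ ρ) (map (conj ∘ group) (dnf φ)) ∼⟨ ⇔.sym (disj-sem _ ρ) ⟩
      ⟦ gdnf φ ⟧ ρ                                    ∎
      where
        open Related.EquationalReasoning
        group≈ : ∀ c → ⟦ conj (group c) ⟧ ρ ⇔ ⟦ c ⟧ᶜ ρ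
        group≈ c = ⇔.trans (conj-sem (group c) ρ)
                           (Merge.group-sem (λ b → ⟦ b ⟧ᵇ ρ) (λ _ _ → ⇔.refl) c)

lemma11 : ExcludedMiddle 0ℓ →
    (S : Signature) (Λ : Set) (sp : Split S Λ) →
    {Γ : List (Signature.Sort S)} (φ : Syntax.Formula S Γ) →
    ∃[ ψ ] (Blocks.IsGDNF sp ψ × Equivalent φ ψ)
lemma11 em S Λ sp φ = gdnf φ , gdnf-isGDNF φ , λ M ρ → gdnf-sem M φ ρ
  where open NormalForm em sp
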